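{- Let $p$ be a prime, $l\ge 0$ an integer, and consider $m\ge 3p^2-2$ variables at the same level $l$. These variables can be contracted into at least $\left\lceil\frac{m+3-3p^2}{p}\right\rceil$ variables at level $l+1$ (by pairwise disjoint contractions), and after these contractions at least $3p^2-p-2$ of the original variables are left (unused) at level $l$. Equivalently: given primitive vectors $v_1,\dots,v_m\in\mathbb{Z}_p^2$ with $m\ge 3p^2-2$, there exist pairwise disjoint nonempty sets $S_1,\dots,S_k\subset\{1,\dots,m\}$ with $k\ge\left\lceil\frac{m+3-3p^2}{p}\right\rceil$, each $|S_j|\le p$, such that for every $j$ both entries of $\sum_{i\in S_j}v_i$ are divisible by $p$ and not both divisible by $p^2$, and $\#\big(\{1,\dots,m\}\setminus\bigcup_j S_j\big)\ge 3p^2-p-2$.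
   Context: A variable $x_i$ with coefficient pair $(a_i,b_i)\in\mathbb{Z}_p^2$ is at level $l$ if $\min\{\operatorname{ord}_p a_i,\operatorname{ord}_p b_i\}=l$, so its coefficient vector is $p^l v_i$ with $v_i\in\mathbb{Z}_p^2$ primitive (not both entries divisible by $p$). A contraction of a set of at most $p$ variables at level $l$ produces a single new variable whose coefficient vector is the sum of their coefficient vectors; it is at level $l+1$ exactly when that sum equals $p^{l+1}w$ with $w$ primitive. -}

module Defs where

open import Data.Nat as ℕ using (ℕ; zero; suc; _^_; _∸_; _+_)
open import Data.Nat.DivMod using (_/_)
open import Data.Integer as ℤ using (ℤ; +_; 0ℤ)
open import Data.Integer.Divisibility.Signed using (_∣_; ∣m∣n⇒∣m+n; divides)
open import Data.Integer.Solver using (module +-*-Solver)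
open import Data.Product using (_×_; _,_; proj₁; proj₂)
open import Data.Fin using (Fin)
open import Data.Fin.Subset using (Subset; _∈_)
open import Data.Vec using (lookup; _∷_)
open import Data.Bool using (if_then_else_)
open import Relation.Nullary using (¬_)
open import Relation.Binary.PropositionalEquality using (_≡_; refl; subst; sym)

-- The p-adic integers ℤ_p, presented as coherent sequences of integer
-- representatives: seq n represents x mod p^n, and
-- seq (n+1) ≡ seq n (mod p^n).
record ℤ[_] (p : ℕ) : Set where
  constructor mkℤp
  field
    seq : ℕ → ℤ
    coh : ∀ n → (+ (p ^ n)) ∣ (seq (suc n) ℤ.- seq n)
open ℤ[_] public

private
  diff-lemma : ∀ a b c d → (a ℤ.+ c) ℤ.- (b ℤ.+ d) ≡ (a ℤ.- b) ℤ.+ (c ℤ.- d)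
  diff-lemma = solve 4 (λ a b c d → (a :+ c) :- (b :+ d) := (a :- b) :+ (c :- d)) refl
    where open +-*-Solver

module _ {p : ℕ} where

  0ₚ : ℤ[ p ]
  0ₚ = mkℤp (λ _ → 0ℤ) (λ n → divides 0ℤ refl)

  _+ₚ_ : ℤ[ p ] → ℤ[ p ] → ℤ[ p ]
  x +ₚ y = mkℤp (λ n → seq x n ℤ.+ seq y n) (λ n →
    subst (λ z → (+ (p ^ n)) ∣ z)
      (sym (diff-lemma (seq x (suc n)) (seq x n) (seq y (suc n)) (seq y n)))
      (∣m∣n⇒∣m+n (coh x n) (coh y n)))

  -- p^k divides x in ℤ_p, i.e. x lies in the ideal p^k ℤ_p, the kernel of
  -- the reduction ℤ_p → ℤ/p^k (x ≡ seq x k mod p^k).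
  _∣ₚ_ : ℕ → ℤ[ p ] → Set
  k ∣ₚ x = (+ (p ^ k)) ∣ seq x k

ℤp² : ℕ → Set
ℤp² p = ℤ[ p ] × ℤ[ p ]

module _ {p : ℕ} where

  0² : ℤp² p
  0² = 0ₚ , 0ₚ

  _+²_ : ℤp² p → ℤp² p → ℤp² p
  (a , b) +² (c , d) = (a +ₚ c) , (b +ₚ d)

  _∣²_ : ℕ → ℤp² p → Set
  k ∣² v = (k ∣ₚ proj₁ v) × (k ∣ₚ proj₂ v)

  Primitive : ℤp² p → Set
  Primitive v = ¬ (1 ∣² v)

  subsetSum : ∀ {m} → (Fin m → ℤp² p) → Subset m → ℤp² p
  subsetSum {zero} v S = 0²
  subsetSum {suc m} v (b ∷ S) =
    (if b then v Fin.zero else 0²) +² subsetSum (λ i → v (Fin.suc i)) S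
    where import Data.Fin as Fin

-- ceiling division ⌈ a / q ⌉ (with ⌈ a / 0 ⌉ = 0 by convention; only q = p prime is used)
⌈_/_⌉ : ℕ → ℕ → ℕ
⌈ a / zero ⌉ = 0
⌈ a / suc q ⌉ = (a + q) / suc q

{-# OPTIONS --safe #-}
module Submission where

-- Work with the coefficient pairs (a, b) modulo p²: a contraction raises the level by exactly one when
-- its sum is ≡ 0 mod p but not ≡ 0 mod p².  Every primitive pair lies on one of the p + 1 lines through
-- the origin of (ℤ/p)², (a, b) ≡ c · (α, β) with c a unit, so among more than (p + 1)·2(p − 1) variables
-- some line carries 2p − 1 of them, and on a line only the scalars c matter.  Any p − 1 units have subset
-- sums covering ℤ/p (adding a unit enlarges the set of reachable sums until it is everything, as a unit
-- generates ℤ/p).  With two disjoint blocks of p − 1 units a telescoping argument finds a subset with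
-- scalar sum ≡ 0 mod p whose pair sum is ≢ 0 mod p², and splitting off zero-sum subsets of size ≤ p
-- shortens it to at most p variables.  Extracting such contractions greedily while at least 3p² − 2
-- variables remain leaves at least 3p² − p − 2 and at most 3p² − 3 of them unused.

open import Defs
open import Data.Bool using (_∧_; if_then_else_)
import Data.Bool.Properties as Bool
open import Data.Empty using (⊥-elim)
open import Data.Fin as Fin using (Fin; zero; suc; toℕ; fromℕ<; _≟_)
import Data.Fin.Properties as Fin
open import Data.Fin.Subset
  using (Subset; inside; outside; _∈_; _∉_; _⊆_; _∩_; _∪_; _─_; ∁; ⊤; ⊥; ⁅_⁆; ⋃; ∣_∣; Nonempty; Empty)
open import Data.Fin.Subset.Properties
open import Data.Integer as ℤ using (ℤ; +_; 0ℤ; 1ℤ)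
import Data.Integer.Properties as ℤ
open import Data.Integer.Divisibility.Signed
  using (_∣_; _∣?_; divides; ∣m∣n⇒∣m+n; ∣m⇒∣-m; ∣n⇒∣m*n; ∣⇒∣ᵤ; *-cancelˡ-∣)
open import Data.Integer.DivMod using (_%ℕ_; _/ℕ_; a≡a%ℕn+[a/ℕn]*n; n%ℕd<d)
open import Data.Integer.Tactic.RingSolver using (solve-∀)
open import Data.List as List using (List; []; _∷_; tabulate)
open import Data.List.Properties using (tabulate-lookup)
open import Data.Nat as ℕ using (ℕ; zero; suc; _≤_; _<_; z≤n; s≤s; z<s; NonZero)
import Data.Nat.Properties as ℕ
import Data.Nat.Divisibility as ℕ
open import Data.Nat.Coprimality using (coprime-Bézout; prime⇒coprime)
import Data.Nat.Coprimality as Coprime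
open import Data.Nat.DivMod using (m<n*o⇒m/o<n)
open import Data.Nat.GCD using (module Bézout)
open import Data.Nat.Primality using (Prime; prime⇒nonZero)
import Data.Nat.Tactic.RingSolver as ℕ-Solver
open import Data.Product as Product using (Σ; ∃; _×_; _,_; proj₁; proj₂)
open import Data.Sum using (_⊎_; inj₁; inj₂)
import Data.Vec as Vec
open import Data.Vec using ([]; _∷_; here; there)
open import Data.Vec.Properties using (lookup∘tabulate; []=⇒lookup; lookup⇒[]=)
open import Function using (_∘_)
open import Relation.Nullary using (¬_; Dec; yes; no; ⌊_⌋; _×-dec_)
open import Relation.Binary.Bundles using (Setoid)
open import Relation.Binary.Structures using (IsEquivalence)
open import Relation.Binary.PropositionalEquality
  using (_≡_; _≢_; refl; sym; trans; cong; cong₂; subst; module ≡-Reasoning)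

open import Algebra.Properties.CommutativeMonoid.Sum ℕ.+-0-commutativeMonoid
  using (sum-syntax; ∑-distrib-+; sum-cong-≗; sum-replicate-zero)

private variable
  m n : ℕ

module Congruences where
  open import Data.Integer using (_+_; _-_; _*_; -_)

  infix 4 _≡_mod_
  record _≡_mod_ (a b n : ℤ) : Set where
    constructor ∣⇒≡mod
    field ≡mod⇒∣ : n ∣ a - b

  private
    ∣-respʳ : ∀ {k a b} → a ≡ b → k ∣ a → k ∣ b
    ∣-respʳ refl k∣a = k∣a

  module _ {n : ℤ} where

    ≡mod-reflexive : ∀ {a b} → a ≡ b → a ≡ b mod n
    ≡mod-reflexive {a} refl = ∣⇒≡mod (∣-respʳ (sym (ℤ.+-inverseʳ a)) (divides 0ℤ refl))

    ≡mod-refl : ∀ {a} → a ≡ a mod n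
    ≡mod-refl = ≡mod-reflexive refl

    ≡mod-sym : ∀ {a b} → a ≡ b mod n → b ≡ a mod n
    ≡mod-sym {a} {b} (∣⇒≡mod n∣a-b) = ∣⇒≡mod (∣-respʳ (eq a b) (∣m⇒∣-m n∣a-b))
      where
      eq : ∀ a b → - (a - b) ≡ b - a
      eq = solve-∀

    ≡mod-trans : ∀ {a b c} → a ≡ b mod n → b ≡ c mod n → a ≡ c mod n
    ≡mod-trans {a} {b} {c} (∣⇒≡mod n∣a-b) (∣⇒≡mod n∣b-c) =
      ∣⇒≡mod (∣-respʳ (eq a b c) (∣m∣n⇒∣m+n n∣a-b n∣b-c))
      where
      eq : ∀ a b c → (a - b) + (b - c) ≡ a - c
      eq = solve-∀

    ≡mod-isEquivalence : IsEquivalence (λ a b → a ≡ b mod n)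
    ≡mod-isEquivalence = record { refl = ≡mod-refl ; sym = ≡mod-sym ; trans = ≡mod-trans }

    +-cong-mod : ∀ {a b c d} → a ≡ b mod n → c ≡ d mod n → a + c ≡ b + d mod n
    +-cong-mod {a} {b} {c} {d} (∣⇒≡mod n∣a-b) (∣⇒≡mod n∣c-d) =
      ∣⇒≡mod (∣-respʳ (eq a b c d) (∣m∣n⇒∣m+n n∣a-b n∣c-d))
      where
      eq : ∀ a b c d → (a - b) + (c - d) ≡ (a + c) - (b + d)
      eq = solve-∀

    +-congˡ-mod : ∀ a {b c} → b ≡ c mod n → a + b ≡ a + c mod n
    +-congˡ-mod a = +-cong-mod (≡mod-refl {a})

    +-congʳ-mod : ∀ c {a b} → a ≡ b mod n → a + c ≡ b + c mod n
    +-congʳ-mod c a≡b = +-cong-mod a≡b (≡mod-refl {c})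

    *-congˡ-mod : ∀ k {a b} → a ≡ b mod n → k * a ≡ k * b mod n
    *-congˡ-mod k {a} {b} (∣⇒≡mod n∣a-b) = ∣⇒≡mod (∣-respʳ (eq k a b) (∣n⇒∣m*n k n∣a-b))
      where
      eq : ∀ k a b → k * (a - b) ≡ k * a - k * b
      eq = solve-∀

    -‿cong-mod : ∀ {a b} → a ≡ b mod n → - a ≡ - b mod n
    -‿cong-mod {a} {b} (∣⇒≡mod n∣a-b) = ∣⇒≡mod (∣-respʳ (eq a b) (∣m⇒∣-m n∣a-b))
      where
      eq : ∀ a b → - (a - b) ≡ - a - - b
      eq = solve-∀

    ∣⇒≡0-mod : ∀ {a} → n ∣ a → a ≡ 0ℤ mod n
    ∣⇒≡0-mod {a} n∣a = ∣⇒≡mod (∣-respʳ (sym (ℤ.+-identityʳ a)) n∣a)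

    ≡0-mod⇒∣ : ∀ {a} → a ≡ 0ℤ mod n → n ∣ a
    ≡0-mod⇒∣ {a} (∣⇒≡mod n∣a-0) = ∣-respʳ (ℤ.+-identityʳ a) n∣a-0

    n*≡0-mod : ∀ k → n * k ≡ 0ℤ mod n
    n*≡0-mod k = ∣⇒≡0-mod (divides k (ℤ.*-comm n k))

    +*n≡-mod : ∀ a k → a + k * n ≡ a mod n
    +*n≡-mod a k = ∣⇒≡mod (∣-respʳ (eq a k n) (divides k refl))
      where
      eq : ∀ a k n → k * n ≡ a + k * n - a
      eq = solve-∀

  ≡mod-setoid : ℤ → Setoid _ _
  ≡mod-setoid n = record { isEquivalence = ≡mod-isEquivalence {n} }

  module ≡mod-Reasoning (n : ℤ) where
    open import Relation.Binary.Reasoning.Setoid (≡mod-setoid n) public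

  module Residues (p : ℕ) .{{_ : NonZero p}} where

    residue : ℤ → Fin p
    residue z = fromℕ< (n%ℕd<d z p)

    ≡residue : ∀ z → z ≡ + toℕ (residue z) mod + p
    ≡residue z = ∣⇒≡mod (divides (z /ℕ p) (begin
      z - + toℕ (residue z)        ≡⟨ cong (λ r → z - + r) (Fin.toℕ-fromℕ< (n%ℕd<d z p)) ⟩
      z - + (z %ℕ p)               ≡⟨ cong (_- + (z %ℕ p)) (a≡a%ℕn+[a/ℕn]*n z p) ⟩
      + (z %ℕ p) + (z /ℕ p) * + p - + (z %ℕ p) ≡⟨ eq (+ (z %ℕ p)) ((z /ℕ p) * + p) ⟩
      (z /ℕ p) * + p               ∎))
      where
      open ≡-Reasoning
      eq : ∀ r q → r + q - r ≡ q
      eq = solve-∀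

    private
      <∧∣⇒≡0 : ∀ {d} → d < p → p ℕ.∣ d → d ≡ 0
      <∧∣⇒≡0 {zero}  _   _   = refl
      <∧∣⇒≡0 {suc d} d<p p∣d = ⊥-elim (ℕ.>⇒∤ d<p p∣d)

      ≡mod-unique-≤ : ∀ {x y} → x < p → y ℕ.≤ x → + x ≡ + y mod + p → x ≡ y
      ≡mod-unique-≤ {x} {y} x<p y≤x (∣⇒≡mod p∣x-y) = ℕ.≤-antisym (ℕ.m∸n≡0⇒m≤n x∸y≡0) y≤x
        where
        x∸y≡0 : x ℕ.∸ y ≡ 0
        x∸y≡0 = <∧∣⇒≡0 (ℕ.≤-<-trans (ℕ.m∸n≤m x y) x<p)
                  (∣⇒∣ᵤ (∣-respʳ (trans (ℤ.m-n≡m⊖n x y) (ℤ.⊖-≥ y≤x)) p∣x-y))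

    ≡mod-unique : ∀ {x y} → x < p → y < p → + x ≡ + y mod + p → x ≡ y
    ≡mod-unique {x} {y} x<p y<p x≡y with ℕ.≤-total y x
    ... | inj₁ y≤x = ≡mod-unique-≤ x<p y≤x x≡y
    ... | inj₂ x≤y = sym (≡mod-unique-≤ y<p x≤y (≡mod-sym x≡y))

    residue-cong : ∀ {a b} → a ≡ b mod + p → residue a ≡ residue b
    residue-cong {a} {b} a≡b = Fin.toℕ-injective (≡mod-unique (Fin.toℕ<n _) (Fin.toℕ<n _)
      (≡mod-trans (≡mod-sym (≡residue a)) (≡mod-trans a≡b (≡residue b))))

    residue-toℕ : ∀ k → residue (+ toℕ k) ≡ k
    residue-toℕ k = Fin.toℕ-injective (≡mod-unique (Fin.toℕ<n _) (Fin.toℕ<n k) (≡mod-sym (≡residue (+ toℕ k))))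

  Unit : ℕ → ℤ → Set
  Unit p a = ¬ (+ p ∣ a)

  module _ {p : ℕ} (p-prime : Prime p) where
    private instance _ = prime⇒nonZero p-prime
    open Residues p

    inverse-mod : ∀ {a} → Unit p a → ∃ λ a⁻¹ → a * a⁻¹ ≡ 1ℤ mod + p
    inverse-mod {a} a-unit with toℕ (residue a) in r≡ | Fin.toℕ<n (residue a)
    ... | zero  | _   = ⊥-elim (a-unit (≡0-mod⇒∣ (subst (λ r → a ≡ + r mod + p) r≡ (≡residue a))))
    ... | suc r | r<p = from-Bézout (coprime-Bézout (Coprime.sym (prime⇒coprime p-prime r<p)))
      where
      a≡r : a ≡ + suc r mod + p
      a≡r = subst (λ r → a ≡ + r mod + p) r≡ (≡residue a)
      open ≡mod-Reasoning (+ p)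
      from-Bézout : Bézout.Identity 1 (suc r) p → ∃ λ a⁻¹ → a * a⁻¹ ≡ 1ℤ mod + p
      from-Bézout (Bézout.+- x y eq) = + x , (begin
        a * + x              ≡⟨ ℤ.*-comm a (+ x) ⟩
        + x * a              ≈⟨ *-congˡ-mod (+ x) a≡r ⟩
        + x * + suc r        ≡⟨ ℤ.pos-* x (suc r) ⟨
        + (x ℕ.* suc r)      ≡⟨ cong +_ eq ⟨
        1ℤ + + (y ℕ.* p)     ≡⟨ cong (λ z → 1ℤ + z) (ℤ.pos-* y p) ⟩
        1ℤ + + y * + p       ≈⟨ +*n≡-mod 1ℤ (+ y) ⟩
        1ℤ                   ∎)
      from-Bézout (Bézout.-+ x y eq) = - + x , (begin
        a * - + x                  ≡⟨ ℤ.*-comm a (- + x) ⟩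
        - + x * a                  ≈⟨ *-congˡ-mod (- + x) a≡r ⟩
        - + x * + suc r            ≡⟨ neg (+ x) (+ suc r) ⟩
        1ℤ - (1ℤ + + x * + suc r)  ≡⟨ cong (λ z → 1ℤ - (1ℤ + z)) (ℤ.pos-* x (suc r)) ⟨
        1ℤ - + (1 ℕ.+ x ℕ.* suc r) ≡⟨ cong (λ z → 1ℤ - + z) eq ⟩
        1ℤ - + (y ℕ.* p)           ≡⟨ cong (λ z → 1ℤ - z) (ℤ.pos-* y p) ⟩
        1ℤ - + y * + p             ≡⟨ cong (λ z → 1ℤ + z) (ℤ.neg-distribˡ-* (+ y) (+ p)) ⟩
        1ℤ + - + y * + p           ≈⟨ +*n≡-mod 1ℤ (- + y) ⟩
        1ℤ                         ∎)
        where
        neg : ∀ x r → - x * r ≡ 1ℤ - (1ℤ + x * r)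
        neg = solve-∀

  telescope-step : ∀ {n A B′ B X j} → A + B′ ≡ 0ℤ mod n → X + (A + B) ≡ 0ℤ mod n →
                   B ≡ j * X mod n → B′ ≡ (1ℤ + j) * X mod n
  telescope-step {n} {A} {B′} {B} {X} {j} A+B′≡0 X+A+B≡0 B≡jX = begin
    B′                                   ≡⟨ eq₁ A B′ B X ⟩
    (A + B′) - (X + (A + B)) + (X + B)   ≈⟨ +-cong-mod (+-cong-mod A+B′≡0 (-‿cong-mod X+A+B≡0)) (+-congˡ-mod X B≡jX) ⟩
    0ℤ - 0ℤ + (X + j * X)                ≡⟨ eq₂ X j ⟩
    (1ℤ + j) * X                         ∎
    where
    open ≡mod-Reasoning n
    eq₁ : ∀ A B′ B X → B′ ≡ (A + B′) - (X + (A + B)) + (X + B)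
    eq₁ = solve-∀
    eq₂ : ∀ X j → 0ℤ - 0ℤ + (X + j * X) ≡ (1ℤ + j) * X
    eq₂ = solve-∀

  p²∣X+[p-1]X⇒p∣X : ∀ {p} .{{_ : ℕ.NonZero p}} {X B} → + (p ℕ.^ 2) ∣ X + B →
                    B ≡ + ℕ.pred p * X mod + (p ℕ.^ 2) → + p ∣ X
  p²∣X+[p-1]X⇒p∣X {p} {X} {B} p²∣X+B B≡[p-1]X =
    *-cancelˡ-∣ (+ p) (subst (_∣ + p * X) p²≡p*p (≡0-mod⇒∣ (begin
      + p * X                  ≡⟨ cong (λ k → + k * X) (ℕ.suc-pred p) ⟨
      (1ℤ + + ℕ.pred p) * X    ≡⟨ eq X (+ ℕ.pred p) ⟩
      X + + ℕ.pred p * X       ≈⟨ +-congˡ-mod X (≡mod-sym B≡[p-1]X) ⟩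
      X + B                    ≈⟨ ∣⇒≡0-mod p²∣X+B ⟩
      0ℤ                       ∎)))
    where
    open ≡mod-Reasoning (+ (p ℕ.^ 2))
    eq : ∀ X k → (1ℤ + k) * X ≡ X + k * X
    eq = solve-∀
    p²≡p*p : + (p ℕ.^ 2) ≡ + p * + p
    p²≡p*p = trans (cong (λ k → + (p ℕ.* k)) (ℕ.*-identityʳ p)) (ℤ.pos-* p p)

open Congruences

module SubsetSums where
  open import Data.Integer using (_+_; _-_; _*_; -_)

  Σₛ : (Fin m → ℤ) → Subset m → ℤ
  Σₛ f []            = 0ℤ
  Σₛ f (inside ∷ S)  = f zero + Σₛ (f ∘ suc) S
  Σₛ f (outside ∷ S) = Σₛ (f ∘ suc) S

  Σₛ-⊥ : ∀ (f : Fin m → ℤ) → Σₛ f ⊥ ≡ 0ℤ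
  Σₛ-⊥ {zero}  f = refl
  Σₛ-⊥ {suc m} f = Σₛ-⊥ (f ∘ suc)

  Σₛ-⁅⁆ : ∀ (f : Fin m → ℤ) x → Σₛ f ⁅ x ⁆ ≡ f x
  Σₛ-⁅⁆ f zero    = trans (cong (_+_ (f zero)) (Σₛ-⊥ (f ∘ suc))) (ℤ.+-identityʳ (f zero))
  Σₛ-⁅⁆ f (suc x) = Σₛ-⁅⁆ (f ∘ suc) x

  Σₛ-∪ : ∀ (f : Fin m → ℤ) S T → Empty (S ∩ T) → Σₛ f (S ∪ T) ≡ Σₛ f S + Σₛ f T
  Σₛ-∪ f []            []            _ = refl
  Σₛ-∪ f (inside ∷ S)  (inside ∷ T)  e = ⊥-elim (e (zero , here))
  Σₛ-∪ f (inside ∷ S)  (outside ∷ T) e = trans (cong (_+_ (f zero)) (Σₛ-∪ (f ∘ suc) S T (drop-∷-Empty e)))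
                                                (sym (ℤ.+-assoc (f zero) _ _))
  Σₛ-∪ f (outside ∷ S) (inside ∷ T)  e = trans (cong (_+_ (f zero)) (Σₛ-∪ (f ∘ suc) S T (drop-∷-Empty e)))
                                                (swap (f zero) (Σₛ (f ∘ suc) S) (Σₛ (f ∘ suc) T))
    where
    swap : ∀ x a b → x + (a + b) ≡ a + (x + b)
    swap = solve-∀
  Σₛ-∪ f (outside ∷ S) (outside ∷ T) e = Σₛ-∪ (f ∘ suc) S T (drop-∷-Empty e)

  ∣p∪q∣≡∣p∣+∣q∣ : ∀ (S T : Subset m) → Empty (S ∩ T) → ∣ S ∪ T ∣ ≡ ∣ S ∣ ℕ.+ ∣ T ∣
  ∣p∪q∣≡∣p∣+∣q∣ []            []            _ = refl
  ∣p∪q∣≡∣p∣+∣q∣ (inside ∷ S)  (inside ∷ T)  e = ⊥-elim (e (zero , here))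
  ∣p∪q∣≡∣p∣+∣q∣ (inside ∷ S)  (outside ∷ T) e = cong suc (∣p∪q∣≡∣p∣+∣q∣ S T (drop-∷-Empty e))
  ∣p∪q∣≡∣p∣+∣q∣ (outside ∷ S) (inside ∷ T)  e = trans (cong suc (∣p∪q∣≡∣p∣+∣q∣ S T (drop-∷-Empty e)))
                                                      (sym (ℕ.+-suc ∣ S ∣ ∣ T ∣))
  ∣p∪q∣≡∣p∣+∣q∣ (outside ∷ S) (outside ∷ T) e = ∣p∪q∣≡∣p∣+∣q∣ S T (drop-∷-Empty e)

  p─q∪q≡p : ∀ {S T : Subset m} → T ⊆ S → (S ─ T) ∪ T ≡ S
  p─q∪q≡p {S = []}          {[]}          _   = refl
  p─q∪q≡p {S = outside ∷ S} {inside ∷ T}  T⊆S with () ← T⊆S here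
  p─q∪q≡p {S = inside ∷ S}  {inside ∷ T}  T⊆S = cong (inside ∷_) (p─q∪q≡p (drop-∷-⊆ T⊆S))
  p─q∪q≡p {S = s ∷ S}       {outside ∷ T} T⊆S = cong₂ _∷_ (Bool.∨-identityʳ s) (p─q∪q≡p (drop-∷-⊆ T⊆S))

  x∈p─q⇒x∉q : ∀ {S T : Subset m} {x} → x ∈ S ─ T → x ∉ T
  x∈p─q⇒x∉q {S = _ ∷ _} {outside ∷ _} here       ()
  x∈p─q⇒x∉q {S = _ ∷ _} {_ ∷ _}       (there x∈) (there x∈′) = x∈p─q⇒x∉q x∈ x∈′

  Empty-─∩ : ∀ (S T : Subset m) → Empty ((S ─ T) ∩ T)
  Empty-─∩ S T (x , x∈) = let x∈S─T , x∈T = x∈p∩q⁻ (S ─ T) T x∈ in x∈p─q⇒x∉q x∈S─T x∈T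

  Empty-∩-sym : ∀ {S T : Subset m} → Empty (S ∩ T) → Empty (T ∩ S)
  Empty-∩-sym {S = S} {T} S∩T≡∅ (x , x∈) = let x∈T , x∈S = x∈p∩q⁻ T S x∈ in S∩T≡∅ (x , x∈p∩q⁺ (x∈S , x∈T))

  Empty-∩-⊆ : ∀ {S S′ T T′ : Subset m} → S′ ⊆ S → T′ ⊆ T → Empty (S ∩ T) → Empty (S′ ∩ T′)
  Empty-∩-⊆ {S′ = S′} {T′ = T′} S′⊆S T′⊆T e (x , x∈) =
    let x∈S′ , x∈T′ = x∈p∩q⁻ S′ T′ x∈ in e (x , x∈p∩q⁺ (S′⊆S x∈S′ , T′⊆T x∈T′))

  Σₛ-─ : ∀ (f : Fin m → ℤ) {S T} → T ⊆ S → Σₛ f S ≡ Σₛ f (S ─ T) + Σₛ f T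
  Σₛ-─ f {S} {T} T⊆S = trans (cong (Σₛ f) (sym (p─q∪q≡p T⊆S))) (Σₛ-∪ f (S ─ T) T (Empty-─∩ S T))

  ∣p∣≡∣p─q∣+∣q∣ : ∀ {S T : Subset m} → T ⊆ S → ∣ S ∣ ≡ ∣ S ─ T ∣ ℕ.+ ∣ T ∣
  ∣p∣≡∣p─q∣+∣q∣ {S = S} {T} T⊆S = trans (cong ∣_∣ (sym (p─q∪q≡p T⊆S))) (∣p∪q∣≡∣p∣+∣q∣ (S ─ T) T (Empty-─∩ S T))

  Σₛ-cong-mod : ∀ {n} {f g : Fin m → ℤ} S → (∀ {i} → i ∈ S → f i ≡ g i mod n) → Σₛ f S ≡ Σₛ g S mod n
  Σₛ-cong-mod []            _   = ≡mod-refl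
  Σₛ-cong-mod (inside ∷ S)  f≡g = +-cong-mod (f≡g here) (Σₛ-cong-mod S (f≡g ∘ there))
  Σₛ-cong-mod (outside ∷ S) f≡g = Σₛ-cong-mod S (f≡g ∘ there)

  Σₛ-*ˡ : ∀ k (f : Fin m → ℤ) S → Σₛ (λ i → k * f i) S ≡ k * Σₛ f S
  Σₛ-*ˡ k f []            = sym (ℤ.*-zeroʳ k)
  Σₛ-*ˡ k f (inside ∷ S)  = trans (cong (_+_ (k * f zero)) (Σₛ-*ˡ k (f ∘ suc) S))
                                  (sym (ℤ.*-distribˡ-+ k (f zero) (Σₛ (f ∘ suc) S)))
  Σₛ-*ˡ k f (outside ∷ S) = Σₛ-*ˡ k (f ∘ suc) S

  ∪-mono-⊆ : ∀ {S S′ T T′ : Subset m} → S ⊆ S′ → T ⊆ T′ → S ∪ T ⊆ S′ ∪ T′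
  ∪-mono-⊆ {S = S} {T = T} S⊆S′ T⊆T′ x∈ with x∈p∪q⁻ S T x∈
  ... | inj₁ x∈S = x∈p∪q⁺ (inj₁ (S⊆S′ x∈S))
  ... | inj₂ x∈T = x∈p∪q⁺ (inj₂ (T⊆T′ x∈T))

  ∪-least : ∀ {S T U : Subset m} → S ⊆ U → T ⊆ U → S ∪ T ⊆ U
  ∪-least {S = S} {T} S⊆U T⊆U x∈ with x∈p∪q⁻ S T x∈
  ... | inj₁ x∈S = S⊆U x∈S
  ... | inj₂ x∈T = T⊆U x∈T

  x∈p⇒⁅x⁆⊆p : ∀ {S : Subset m} {x} → x ∈ S → ⁅ x ⁆ ⊆ S
  x∈p⇒⁅x⁆⊆p {S = S} {x} x∈S y∈⁅x⁆ = subst (_∈ S) (sym (x∈⁅y⁆⇒x≡y x y∈⁅x⁆)) x∈S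

  ∣p∣≡1+∣p─⁅x⁆∣ : ∀ {S : Subset m} {x} → x ∈ S → ∣ S ∣ ≡ suc ∣ S ─ ⁅ x ⁆ ∣
  ∣p∣≡1+∣p─⁅x⁆∣ {S = S} {x} x∈S = begin
    ∣ S ∣                         ≡⟨ ∣p∣≡∣p─q∣+∣q∣ (x∈p⇒⁅x⁆⊆p x∈S) ⟩
    ∣ S ─ ⁅ x ⁆ ∣ ℕ.+ ∣ ⁅ x ⁆ ∣    ≡⟨ cong (∣ S ─ ⁅ x ⁆ ∣ ℕ.+_) (∣⁅x⁆∣≡1 x) ⟩
    ∣ S ─ ⁅ x ⁆ ∣ ℕ.+ 1           ≡⟨ ℕ.+-comm ∣ S ─ ⁅ x ⁆ ∣ 1 ⟩
    suc ∣ S ─ ⁅ x ⁆ ∣             ∎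
    where open ≡-Reasoning

  ∣p∣>0⇒Nonempty : ∀ (S : Subset m) → 0 < ∣ S ∣ → Nonempty S
  ∣p∣>0⇒Nonempty (inside ∷ S)  _   = zero , here
  ∣p∣>0⇒Nonempty (outside ∷ S) ∣S∣>0 = Product.map suc there (∣p∣>0⇒Nonempty S ∣S∣>0)

  subset-of-size : ∀ {k} (S : Subset m) → k ≤ ∣ S ∣ → ∃ λ T → T ⊆ S × ∣ T ∣ ≡ k
  subset-of-size {m} {zero} S _ = ⊥ , ⊥⊆ , ∣⊥∣≡0 m
  subset-of-size {k = suc k} (outside ∷ S) 1+k≤∣S∣     =
    let T , T⊆S , ∣T∣≡k = subset-of-size S 1+k≤∣S∣ in outside ∷ T , s⊆s T⊆S , ∣T∣≡k
  subset-of-size {k = suc k} (inside ∷ S)  (s≤s k≤∣S∣) =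
    let T , T⊆S , ∣T∣≡k = subset-of-size S k≤∣S∣ in inside ∷ T , s⊆s T⊆S , cong suc ∣T∣≡k

  disjoint-subsets-of-size : ∀ {k} (S : Subset m) → k ℕ.+ k ≤ ∣ S ∣ →
                             ∃ λ T₁ → ∃ λ T₂ → T₁ ⊆ S × T₂ ⊆ S × Empty (T₁ ∩ T₂) × k ≤ ∣ T₁ ∣ × k ≤ ∣ T₂ ∣
  disjoint-subsets-of-size {k = k} S 2k≤∣S∣ with subset-of-size S (ℕ.≤-trans (ℕ.m≤m+n k k) 2k≤∣S∣)
  ... | T , T⊆S , ∣T∣≡k =
    T , S ─ T , T⊆S , p─q⊆p S T , Empty-∩-sym (Empty-─∩ S T) , ℕ.≤-reflexive (sym ∣T∣≡k) ,
    ℕ.+-cancelʳ-≤ k k ∣ S ─ T ∣ (begin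
      k ℕ.+ k                ≤⟨ 2k≤∣S∣ ⟩
      ∣ S ∣                  ≡⟨ ∣p∣≡∣p─q∣+∣q∣ T⊆S ⟩
      ∣ S ─ T ∣ ℕ.+ ∣ T ∣    ≡⟨ cong (∣ S ─ T ∣ ℕ.+_) ∣T∣≡k ⟩
      ∣ S ─ T ∣ ℕ.+ k        ∎)
    where open ℕ.≤-Reasoning

  ⊤─p≡∁p : ∀ (S : Subset m) → ⊤ ─ S ≡ ∁ S
  ⊤─p≡∁p []            = refl
  ⊤─p≡∁p (inside ∷ S)  = cong (outside ∷_) (⊤─p≡∁p S)
  ⊤─p≡∁p (outside ∷ S) = cong (inside ∷_) (⊤─p≡∁p S)

open SubsetSums

module SubsetSumsModPrime {p : ℕ} (p-prime : Prime p) where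
  private instance _ = prime⇒nonZero p-prime
  open import Data.Integer using (_+_; _-_; _*_; -_)
  open Residues p

  Units : ∀ {m} → (Fin m → ℤ) → Subset m → Set
  Units c U = ∀ {i} → i ∈ U → Unit p (c i)

  shift : Subset p → ℤ → Subset p
  shift R t = Vec.tabulate (λ i → Vec.lookup R (residue (+ toℕ i - t)))

  ∈-shift⁻ : ∀ {R t i} → i ∈ shift R t → residue (+ toℕ i - t) ∈ R
  ∈-shift⁻ {R} {t} {i} i∈ = lookup⇒[]= _ R (trans (sym (lookup∘tabulate _ i)) ([]=⇒lookup i∈))

  ∈-shift⁺ : ∀ {R t i} → residue (+ toℕ i - t) ∈ R → i ∈ shift R t
  ∈-shift⁺ {R} {t} {i} i-t∈ = lookup⇒[]= i (shift R t) (trans (lookup∘tabulate _ i) ([]=⇒lookup i-t∈))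

  shift-⊆⇒+-closed : ∀ {R t} → shift R t ⊆ R → ∀ {i} → i ∈ R → residue (+ toℕ i + t) ∈ R
  shift-⊆⇒+-closed {R} {t} shift⊆R {i} i∈R = shift⊆R (∈-shift⁺ {R} {t} (subst (_∈ R) (sym i+t-t≡i) i∈R))
    where
    i+t-t≡i : residue (+ toℕ (residue (+ toℕ i + t)) - t) ≡ i
    i+t-t≡i = trans (residue-cong (begin
      + toℕ (residue (+ toℕ i + t)) - t ≈⟨ +-congʳ-mod (- t) (≡mod-sym (≡residue (+ toℕ i + t))) ⟩
      + toℕ i + t - t                    ≡⟨ eq (+ toℕ i) t ⟩
      + toℕ i                            ∎)) (residue-toℕ i)
      where
      open ≡mod-Reasoning (+ p)
      eq : ∀ a b → a + b - b ≡ a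
      eq = solve-∀

  +-closed⇒+n*-closed : ∀ {R t} → (∀ {i} → i ∈ R → residue (+ toℕ i + t) ∈ R) →
                        ∀ {i} → i ∈ R → ∀ n → residue (+ toℕ i + + n * t) ∈ R
  +-closed⇒+n*-closed {R} {t} closed {i} i∈R zero =
    subst (_∈ R) (trans (sym (residue-toℕ i)) (residue-cong (≡mod-reflexive (eq (+ toℕ i) t)))) i∈R
    where
    eq : ∀ a t → a ≡ a + + 0 * t
    eq = solve-∀
  +-closed⇒+n*-closed {R} {t} closed {i} i∈R (suc n) = subst (_∈ R) (residue-cong (begin
    + toℕ (residue (i′ + + n * t)) + t ≈⟨ +-congʳ-mod t (≡mod-sym (≡residue (i′ + + n * t))) ⟩
    i′ + + n * t + t                   ≡⟨ eq i′ (+ n) t ⟩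
    i′ + + suc n * t                   ∎)) (closed (+-closed⇒+n*-closed closed i∈R n))
    where
    open ≡mod-Reasoning (+ p)
    i′ : ℤ
    i′ = + toℕ i
    eq : ∀ a n t → a + n * t + t ≡ a + (1ℤ + n) * t
    eq = solve-∀

  +-closed⇒full : ∀ {R t} → Unit p t → (∀ {i} → i ∈ R → residue (+ toℕ i + t) ∈ R) →
                  Nonempty R → ∀ j → j ∈ R
  +-closed⇒full {R} {t} t-unit closed (i , i∈R) j =
    subst (_∈ R) (trans (residue-cong i+kt≡j) (residue-toℕ j)) (+-closed⇒+n*-closed closed i∈R k)
    where
    open ≡mod-Reasoning (+ p)
    i′ j′ t⁻¹ : ℤ
    i′  = + toℕ i
    j′  = + toℕ j
    t⁻¹ = proj₁ (inverse-mod p-prime t-unit)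
    k : ℕ
    k = toℕ (residue ((j′ - i′) * t⁻¹))
    i+kt≡j : i′ + + k * t ≡ j′ mod + p
    i+kt≡j = begin
      i′ + + k * t                ≡⟨ cong (_+_ i′) (ℤ.*-comm (+ k) t) ⟩
      i′ + t * + k                ≈⟨ +-congˡ-mod i′ (*-congˡ-mod t (≡mod-sym (≡residue ((j′ - i′) * t⁻¹)))) ⟩
      i′ + t * ((j′ - i′) * t⁻¹)  ≡⟨ eq₁ i′ j′ t t⁻¹ ⟩
      i′ + (j′ - i′) * (t * t⁻¹)  ≈⟨ +-congˡ-mod i′ (*-congˡ-mod (j′ - i′) (proj₂ (inverse-mod p-prime t-unit))) ⟩
      i′ + (j′ - i′) * 1ℤ         ≡⟨ eq₂ i′ j′ ⟩
      j′                          ∎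
      where
      eq₁ : ∀ i j t t⁻¹ → i + t * ((j - i) * t⁻¹) ≡ i + (j - i) * (t * t⁻¹)
      eq₁ = solve-∀
      eq₂ : ∀ i j → i + (j - i) * 1ℤ ≡ j
      eq₂ = solve-∀

  ∪-shift-grows : ∀ {R t} → Unit p t → Nonempty R → ∣ R ∣ < p → ∣ R ∣ < ∣ R ∪ shift R t ∣
  ∪-shift-grows {R} {t} t-unit R≠∅ ∣R∣<p with R ⊂? (R ∪ shift R t)
  ... | yes R⊂R′ = p⊂q⇒∣p∣<∣q∣ R⊂R′
  ... | no  R⊄R′ = ⊥-elim (ℕ.<⇒≱ ∣R∣<p (subst (_≤ ∣ R ∣) (∣⊤∣≡n p) ∣⊤∣≤∣R∣))
    where
    shift⊆R : shift R t ⊆ R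
    shift⊆R {x} x∈shift with x ∈? R
    ... | yes x∈R = x∈R
    ... | no  x∉R = ⊥-elim (R⊄R′ (p⊆p∪q (shift R t) , x , x∈p∪q⁺ (inj₂ x∈shift) , x∉R))
    ∣⊤∣≤∣R∣ : ∣ ⊤ {p} ∣ ≤ ∣ R ∣
    ∣⊤∣≤∣R∣ = p⊆q⇒∣p∣≤∣q∣ {p = ⊤}
      (λ {j} _ → +-closed⇒full {R} {t} t-unit (shift-⊆⇒+-closed {R} {t} shift⊆R) R≠∅ j)

  reachable : ∀ {m} → (Fin m → ℤ) → Subset m → Subset p
  reachable c []            = ⁅ residue 0ℤ ⁆
  reachable c (outside ∷ U) = reachable (c ∘ suc) U
  reachable c (inside ∷ U)  = reachable (c ∘ suc) U ∪ shift (reachable (c ∘ suc) U) (c zero)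

  reachable-sound : ∀ {m} (c : Fin m → ℤ) U {i} → i ∈ reachable c U →
                    ∃ λ A → A ⊆ U × Σₛ c A ≡ + toℕ i mod + p
  reachable-sound c [] i∈ with refl ← x∈⁅y⁆⇒x≡y _ i∈ = [] , (λ ()) , ≡residue 0ℤ
  reachable-sound c (outside ∷ U) i∈ =
    let A , A⊆U , ΣA≡i = reachable-sound (c ∘ suc) U i∈ in outside ∷ A , out⊆ A⊆U , ΣA≡i
  reachable-sound c (inside ∷ U) {i} i∈ with x∈p∪q⁻ (reachable (c ∘ suc) U) _ i∈
  ... | inj₁ i∈R =
    let A , A⊆U , ΣA≡i = reachable-sound (c ∘ suc) U i∈R in outside ∷ A , out⊆ A⊆U , ΣA≡i
  ... | inj₂ i∈shift =
    let A , A⊆U , ΣA≡i-c = reachable-sound (c ∘ suc) U (∈-shift⁻ {reachable (c ∘ suc) U} {c zero} i∈shift) in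
    inside ∷ A , in⊆in A⊆U , (begin
      c zero + Σₛ (c ∘ suc) A                         ≈⟨ +-congˡ-mod (c zero) ΣA≡i-c ⟩
      c zero + + toℕ (residue (+ toℕ i - c zero))     ≈⟨ +-congˡ-mod (c zero) (≡mod-sym (≡residue (+ toℕ i - c zero))) ⟩
      c zero + (+ toℕ i - c zero)                     ≡⟨ eq (c zero) (+ toℕ i) ⟩
      + toℕ i                                         ∎)
    where
    open ≡mod-Reasoning (+ p)
    eq : ∀ c i → c + (i - c) ≡ i
    eq = solve-∀

  residue0∈reachable : ∀ {m} (c : Fin m → ℤ) U → residue 0ℤ ∈ reachable c U
  residue0∈reachable c []            = x∈⁅x⁆ _
  residue0∈reachable c (outside ∷ U) = residue0∈reachable (c ∘ suc) U
  residue0∈reachable c (inside ∷ U)  = x∈p∪q⁺ (inj₁ (residue0∈reachable (c ∘ suc) U))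

  reachable-size : ∀ {m} (c : Fin m → ℤ) U → Units c U → ∣ U ∣ < p → ∣ U ∣ < ∣ reachable c U ∣
  reachable-size c []            _     _     = ℕ.≤-reflexive (sym (∣⁅x⁆∣≡1 (residue 0ℤ)))
  reachable-size c (outside ∷ U) units ∣U∣<p = reachable-size (c ∘ suc) U (units ∘ there) ∣U∣<p
  reachable-size c (inside ∷ U)  units ∣U∣<p with ∣ R ∣ ℕ.<? p
    where R = reachable (c ∘ suc) U
  ... | yes ∣R∣<p = ℕ.<-≤-trans (s≤s (reachable-size (c ∘ suc) U (units ∘ there) (ℕ.<⇒≤ ∣U∣<p)))
                      (∪-shift-grows (units here) (_ , residue0∈reachable (c ∘ suc) U) ∣R∣<p)
  ... | no  ∣R∣≮p = ℕ.<-≤-trans ∣U∣<p (ℕ.≤-trans (ℕ.≮⇒≥ ∣R∣≮p) (∣p∣≤∣p∪q∣ R (shift R (c zero))))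
    where R = reachable (c ∘ suc) U

  subset-sums-cover : ∀ {m} (c : Fin m → ℤ) U → Units c U → ℕ.pred p ≤ ∣ U ∣ →
                      ∀ w → ∃ λ A → A ⊆ U × Σₛ c A ≡ w mod + p
  subset-sums-cover c U units p-1≤∣U∣ w with subset-of-size U p-1≤∣U∣
  ... | U′ , U′⊆U , ∣U′∣≡p-1 with reachable-sound c U′ (subst (residue w ∈_) (sym reachable≡⊤) ∈⊤)
    where
    ∣U′∣<p : ∣ U′ ∣ < p
    ∣U′∣<p = subst (_< p) (sym ∣U′∣≡p-1) (ℕ.m≤pred[n]⇒suc[m]≤n ℕ.≤-refl)
    p≤∣R∣ : p ≤ ∣ reachable c U′ ∣
    p≤∣R∣ = subst (_≤ ∣ reachable c U′ ∣) (trans (cong suc ∣U′∣≡p-1) (ℕ.suc-pred p))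
              (reachable-size c U′ (units ∘ U′⊆U) ∣U′∣<p)
    reachable≡⊤ : reachable c U′ ≡ ⊤
    reachable≡⊤ = ∣p∣≡n⇒p≡⊤ (ℕ.≤-antisym (∣p∣≤n (reachable c U′)) p≤∣R∣)
  ... | A , A⊆U′ , ΣA≡w′ = A , ⊆-trans A⊆U′ U′⊆U , ≡mod-trans ΣA≡w′ (≡mod-sym (≡residue w))

fiber : (Fin m → Fin n) → Fin n → Subset m
fiber f ℓ = Vec.tabulate (λ i → ⌊ f i ≟ ℓ ⌋)

∈-fiber⁻ : ∀ {f : Fin m → Fin n} {ℓ i} → i ∈ fiber f ℓ → f i ≡ ℓ
∈-fiber⁻ {f = f} {ℓ} {i} i∈ with f i ≟ ℓ | trans (sym (lookup∘tabulate (λ j → ⌊ f j ≟ ℓ ⌋) i)) ([]=⇒lookup i∈)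
... | yes fi≡ℓ | _ = fi≡ℓ
... | no  _    | ()

private
  ∣x∷p∣ : ∀ x (S : Subset m) → ∣ x ∷ S ∣ ≡ (if x then 1 else 0) ℕ.+ ∣ S ∣
  ∣x∷p∣ inside  S = refl
  ∣x∷p∣ outside S = refl

  ∑-indicator : ∀ (c : Fin n) → ∑[ ℓ < n ] (if ⌊ c ≟ ℓ ⌋ then 1 else 0) ≡ 1
  ∑-indicator {suc n} zero    = cong suc (sum-replicate-zero n)
  ∑-indicator {suc n} (suc c) = trans (sum-cong-≗ (λ ℓ → cong (λ b → if b then 1 else 0) (suc-≟-suc c ℓ)))
                                      (∑-indicator c)
    where
    suc-≟-suc : ∀ {n} (c ℓ : Fin n) → ⌊ suc c ≟ suc ℓ ⌋ ≡ ⌊ c ≟ ℓ ⌋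
    suc-≟-suc c ℓ with c ≟ ℓ
    ... | yes _ = refl
    ... | no  _ = refl

  ∑-bounded : ∀ K (g : Fin n → ℕ) → (∀ ℓ → g ℓ ≤ K) → ∑[ ℓ < n ] g ℓ ≤ n ℕ.* K
  ∑-bounded {zero}  K g g≤K = ℕ.z≤n
  ∑-bounded {suc n} K g g≤K = ℕ.+-mono-≤ (g≤K zero) (∑-bounded K (g ∘ suc) (g≤K ∘ suc))

∣p∣≡∑∣p∩fiber∣ : ∀ (f : Fin m → Fin n) R → ∣ R ∣ ≡ ∑[ ℓ < n ] ∣ R ∩ fiber f ℓ ∣
∣p∣≡∑∣p∩fiber∣ {n = n} f []      = sym (sum-replicate-zero n)
∣p∣≡∑∣p∩fiber∣ {suc m} {n} f (x ∷ R) = begin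
  ∣ x ∷ R ∣                                            ≡⟨ ∣x∷p∣ x R ⟩
  (if x then 1 else 0) ℕ.+ ∣ R ∣                        ≡⟨ cong₂ ℕ._+_ (head-count x) (∣p∣≡∑∣p∩fiber∣ (f ∘ suc) R) ⟩
  ∑[ ℓ < n ] [x∧f0≡ ℓ ] ℕ.+ ∑[ ℓ < n ] ∣ R ∩ F ℓ ∣       ≡⟨ ∑-distrib-+ [x∧f0≡_] (λ ℓ → ∣ R ∩ F ℓ ∣) ⟨
  ∑[ ℓ < n ] ([x∧f0≡ ℓ ] ℕ.+ ∣ R ∩ F ℓ ∣)               ≡⟨ sum-cong-≗ (λ ℓ → sym (∣x∷p∣ _ (R ∩ F ℓ))) ⟩
  ∑[ ℓ < n ] ∣ (x ∷ R) ∩ fiber f ℓ ∣                    ∎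
  where
  open ≡-Reasoning
  F : Fin n → Subset m
  F = fiber (f ∘ suc)
  [x∧f0≡_] : Fin n → ℕ
  [x∧f0≡ ℓ ] = if x ∧ ⌊ f zero ≟ ℓ ⌋ then 1 else 0
  head-count : ∀ x → (if x then 1 else 0) ≡ ∑[ ℓ < n ] (if x ∧ ⌊ f zero ≟ ℓ ⌋ then 1 else 0)
  head-count inside  = sym (∑-indicator (f zero))
  head-count outside = sym (sum-replicate-zero n)

pigeonhole : ∀ K (f : Fin m → Fin n) R → n ℕ.* K < ∣ R ∣ → ∃ λ ℓ → K < ∣ R ∩ fiber f ℓ ∣
pigeonhole {n = n} K f R nK<∣R∣ with Fin.any? (λ ℓ → K ℕ.<? ∣ R ∩ fiber f ℓ ∣)
... | yes large-fiber = large-fiber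
... | no  ¬large      = ⊥-elim (ℕ.<⇒≱ nK<∣R∣ (ℕ.≤-trans (ℕ.≤-reflexive (∣p∣≡∑∣p∩fiber∣ f R))
        (∑-bounded K _ (λ ℓ → ℕ.≮⇒≥ (λ K< → ¬large (ℓ , K<))))))

module NondegenerateZeroSums {p : ℕ} (p-prime : Prime p) {m : ℕ} (a b : Fin m → ℤ) where
  private instance _ = prime⇒nonZero p-prime
  open import Data.Integer using (_+_; _-_; _*_; -_)
  open SubsetSumsModPrime p-prime

  p² : ℤ
  p² = + (p ℕ.^ 2)

  PrimitiveAt : Fin m → Set
  PrimitiveAt i = ¬ ((+ p ∣ a i) × (+ p ∣ b i))

  p²∣Σ : Subset m → Set
  p²∣Σ S = (p² ∣ Σₛ a S) × (p² ∣ Σₛ b S)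

  p²∣Σ? : ∀ S → Dec (p²∣Σ S)
  p²∣Σ? S = (p² ∣? Σₛ a S) ×-dec (p² ∣? Σₛ b S)

  record NondegenerateZeroSum (c : Fin m → ℤ) (X : Subset m) : Set where
    constructor nondegenerate
    field
      set   : Subset m
      ⊆X    : set ⊆ X
      Σc≡0  : Σₛ c set ≡ 0ℤ mod + p
      p²∤Σ  : ¬ p²∣Σ set

  p²∤Σ⇒Nonempty : ∀ {S} → ¬ p²∣Σ S → Nonempty S
  p²∤Σ⇒Nonempty {S} p²∤ΣS with nonempty? S
  ... | yes S≢∅ = S≢∅
  ... | no  S≡∅ = ⊥-elim (p²∤ΣS (p²∣Σ∅ a , p²∣Σ∅ b))
    where
    p²∣Σ∅ : ∀ f → p² ∣ Σₛ f S
    p²∣Σ∅ f = subst (λ X → p² ∣ Σₛ f X) (sym (Empty-unique S≡∅)) (subst (p² ∣_) (sym (Σₛ-⊥ f)) (divides 0ℤ refl))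

  nondegenerate-or-p²∣Σ : ∀ {c X S} → S ⊆ X → Σₛ c S ≡ 0ℤ mod + p → NondegenerateZeroSum c X ⊎ p²∣Σ S
  nondegenerate-or-p²∣Σ {S = S} S⊆X ΣS≡0 with p²∣Σ? S
  ... | yes p²∣ΣS = inj₂ p²∣ΣS
  ... | no  p²∤ΣS = inj₁ (nondegenerate S S⊆X ΣS≡0 p²∤ΣS)

  NondegenerateZeroSum-⊆ : ∀ {c X Y} → X ⊆ Y → NondegenerateZeroSum c X → NondegenerateZeroSum c Y
  NondegenerateZeroSum-⊆ X⊆Y (nondegenerate S S⊆X ΣS≡0 p²∤ΣS) = nondegenerate S (X⊆Y ∘ S⊆X) ΣS≡0 p²∤ΣS

  -- With r = c x, let Aⱼ ⊆ T₁ and Bⱼ ⊆ T₂ have scalar sums −jr and jr.  The sets B₀, Aⱼ ∪ Bⱼ,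
  -- {x} ∪ Aⱼ₊₁ ∪ Bⱼ and {x} ∪ Bₚ₋₁ all have scalar sum ≡ 0 mod p.  If all their pair sums were ≡ 0 mod p²,
  -- induction on j would give Σ_{Bⱼ} ≡ j · (a x, b x) mod p², so {x} ∪ Bₚ₋₁ would sum to p · (a x, b x),
  -- contradicting the primitivity of x.
  module Telescope (c : Fin m → ℤ) (x : Fin m) {T₁ T₂ : Subset m}
                   (units₁ : Units c T₁) (units₂ : Units c T₂)
                   (size₁ : ℕ.pred p ≤ ∣ T₁ ∣) (size₂ : ℕ.pred p ≤ ∣ T₂ ∣)
                   (x∉T₁ : Empty (⁅ x ⁆ ∩ T₁)) (x∉T₂ : Empty (⁅ x ⁆ ∩ T₂))
                   (T₁∩T₂≡∅ : Empty (T₁ ∩ T₂)) where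

    X : Subset m
    X = ⁅ x ⁆ ∪ (T₁ ∪ T₂)

    A-cover : ∀ j → ∃ λ A → A ⊆ T₁ × Σₛ c A ≡ - (+ j * c x) mod + p
    A-cover j = subset-sums-cover c T₁ units₁ size₁ (- (+ j * c x))

    B-cover : ∀ j → ∃ λ B → B ⊆ T₂ × Σₛ c B ≡ + j * c x mod + p
    B-cover j = subset-sums-cover c T₂ units₂ size₂ (+ j * c x)

    A B : ℕ → Subset m
    A = proj₁ ∘ A-cover
    B = proj₁ ∘ B-cover

    A⊆T₁ : ∀ j → A j ⊆ T₁
    A⊆T₁ = proj₁ ∘ proj₂ ∘ A-cover

    B⊆T₂ : ∀ j → B j ⊆ T₂
    B⊆T₂ = proj₁ ∘ proj₂ ∘ B-cover

    ΣA≡-jx : ∀ j → Σₛ c (A j) ≡ - (+ j * c x) mod + p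
    ΣA≡-jx = proj₂ ∘ proj₂ ∘ A-cover

    ΣB≡jx : ∀ j → Σₛ c (B j) ≡ + j * c x mod + p
    ΣB≡jx = proj₂ ∘ proj₂ ∘ B-cover

    Σ-A∪B : ∀ f i j → Σₛ f (A i ∪ B j) ≡ Σₛ f (A i) + Σₛ f (B j)
    Σ-A∪B f i j = Σₛ-∪ f (A i) (B j) (Empty-∩-⊆ (A⊆T₁ i) (B⊆T₂ j) T₁∩T₂≡∅)

    Σ-x∪B : ∀ f j → Σₛ f (⁅ x ⁆ ∪ B j) ≡ f x + Σₛ f (B j)
    Σ-x∪B f j = trans (Σₛ-∪ f ⁅ x ⁆ (B j) (Empty-∩-⊆ ⊆-refl (B⊆T₂ j) x∉T₂)) (cong (_+ Σₛ f (B j)) (Σₛ-⁅⁆ f x))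

    Σ-x∪A∪B : ∀ f i j → Σₛ f (⁅ x ⁆ ∪ (A i ∪ B j)) ≡ f x + (Σₛ f (A i) + Σₛ f (B j))
    Σ-x∪A∪B f i j = trans (Σₛ-∪ f ⁅ x ⁆ (A i ∪ B j) x∉A∪B) (cong₂ _+_ (Σₛ-⁅⁆ f x) (Σ-A∪B f i j))
      where
      x∉A∪B : Empty (⁅ x ⁆ ∩ (A i ∪ B j))
      x∉A∪B (y , y∈) with x∈p∩q⁻ ⁅ x ⁆ (A i ∪ B j) y∈
      ... | y∈x , y∈A∪B with x∈p∪q⁻ (A i) (B j) y∈A∪B
      ...   | inj₁ y∈A = x∉T₁ (y , x∈p∩q⁺ (y∈x , A⊆T₁ i y∈A))
      ...   | inj₂ y∈B = x∉T₂ (y , x∈p∩q⁺ (y∈x , B⊆T₂ j y∈B))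

    A∪B⊆X : ∀ i j → A i ∪ B j ⊆ X
    A∪B⊆X i j = q⊆p∪q ⁅ x ⁆ (T₁ ∪ T₂) ∘ ∪-mono-⊆ (A⊆T₁ i) (B⊆T₂ j)

    x∪A∪B⊆X : ∀ i j → ⁅ x ⁆ ∪ (A i ∪ B j) ⊆ X
    x∪A∪B⊆X i j = ∪-mono-⊆ ⊆-refl (∪-mono-⊆ (A⊆T₁ i) (B⊆T₂ j))

    x∪B⊆X : ∀ j → ⁅ x ⁆ ∪ B j ⊆ X
    x∪B⊆X j = ∪-mono-⊆ ⊆-refl (q⊆p∪q T₁ T₂ ∘ B⊆T₂ j)

    open ≡mod-Reasoning (+ p)

    ΣA∪B≡0 : ∀ j → Σₛ c (A j ∪ B j) ≡ 0ℤ mod + p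
    ΣA∪B≡0 j = begin
      Σₛ c (A j ∪ B j)                  ≡⟨ Σ-A∪B c j j ⟩
      Σₛ c (A j) + Σₛ c (B j)           ≈⟨ +-cong-mod (ΣA≡-jx j) (ΣB≡jx j) ⟩
      - (+ j * c x) + + j * c x         ≡⟨ ℤ.+-inverseˡ (+ j * c x) ⟩
      0ℤ                                ∎

    Σx∪A∪B≡0 : ∀ j → Σₛ c (⁅ x ⁆ ∪ (A (suc j) ∪ B j)) ≡ 0ℤ mod + p
    Σx∪A∪B≡0 j = begin
      Σₛ c (⁅ x ⁆ ∪ (A (suc j) ∪ B j))              ≡⟨ Σ-x∪A∪B c (suc j) j ⟩
      c x + (Σₛ c (A (suc j)) + Σₛ c (B j))         ≈⟨ +-congˡ-mod (c x) (+-cong-mod (ΣA≡-jx (suc j)) (ΣB≡jx j)) ⟩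
      c x + (- ((1ℤ + + j) * c x) + + j * c x)      ≡⟨ eq (c x) (+ j) ⟩
      0ℤ                                            ∎
      where
      eq : ∀ r j → r + (- ((1ℤ + j) * r) + j * r) ≡ 0ℤ
      eq = solve-∀

    Σx∪B≡0 : Σₛ c (⁅ x ⁆ ∪ B (ℕ.pred p)) ≡ 0ℤ mod + p
    Σx∪B≡0 = begin
      Σₛ c (⁅ x ⁆ ∪ B (ℕ.pred p))        ≡⟨ Σ-x∪B c (ℕ.pred p) ⟩
      c x + Σₛ c (B (ℕ.pred p))          ≈⟨ +-congˡ-mod (c x) (ΣB≡jx (ℕ.pred p)) ⟩
      c x + + ℕ.pred p * c x             ≡⟨ eq (c x) (+ ℕ.pred p) ⟩
      (1ℤ + + ℕ.pred p) * c x            ≡⟨ cong (λ k → + k * c x) (ℕ.suc-pred p) ⟩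
      + p * c x                          ≈⟨ n*≡0-mod (c x) ⟩
      0ℤ                                 ∎
      where
      eq : ∀ r k → r + k * r ≡ (1ℤ + k) * r
      eq = solve-∀

    Telescoped : (Fin m → ℤ) → ℕ → Set
    Telescoped f j = Σₛ f (B j) ≡ + j * f x mod p²

    telescoped-suc : ∀ f j → p² ∣ Σₛ f (A (suc j) ∪ B (suc j)) → p² ∣ Σₛ f (⁅ x ⁆ ∪ (A (suc j) ∪ B j)) →
                     Telescoped f j → Telescoped f (suc j)
    telescoped-suc f j p²∣E p²∣F = telescope-step {A = Σₛ f (A (suc j))} {X = f x} {j = + j}
      (subst (_≡ 0ℤ mod p²) (Σ-A∪B f (suc j) (suc j)) (∣⇒≡0-mod p²∣E))
      (subst (_≡ 0ℤ mod p²) (Σ-x∪A∪B f (suc j) j) (∣⇒≡0-mod p²∣F))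

    telescoped-zero : ∀ f → p² ∣ Σₛ f (B 0) → Telescoped f 0
    telescoped-zero f p²∣B₀ = ≡mod-trans (∣⇒≡0-mod p²∣B₀) (≡mod-reflexive (sym (ℤ.*-zeroˡ (f x))))

    search : ∀ j → NondegenerateZeroSum c X ⊎ (Telescoped a j × Telescoped b j)
    search zero with nondegenerate-or-p²∣Σ (q⊆p∪q ⁅ x ⁆ (T₁ ∪ T₂) ∘ q⊆p∪q T₁ T₂ ∘ B⊆T₂ 0)
                             (≡mod-trans (ΣB≡jx 0) (≡mod-reflexive (ℤ.*-zeroˡ (c x))))
    ... | inj₁ found           = inj₁ found
    ... | inj₂ (p²∣Ba , p²∣Bb) = inj₂ (telescoped-zero a p²∣Ba , telescoped-zero b p²∣Bb)
    search (suc j) with search j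
                      | nondegenerate-or-p²∣Σ (A∪B⊆X (suc j) (suc j)) (ΣA∪B≡0 (suc j))
                      | nondegenerate-or-p²∣Σ (x∪A∪B⊆X (suc j) j) (Σx∪A∪B≡0 j)
    ... | inj₁ found | _ | _ = inj₁ found
    ... | inj₂ _ | inj₁ found | _ = inj₁ found
    ... | inj₂ _ | inj₂ _ | inj₁ found = inj₁ found
    ... | inj₂ (tel-a , tel-b) | inj₂ (p²∣Ea , p²∣Eb) | inj₂ (p²∣Fa , p²∣Fb) =
      inj₂ (telescoped-suc a j p²∣Ea p²∣Fa tel-a , telescoped-suc b j p²∣Eb p²∣Fb tel-b)

    nondegenerate-zero-sum : PrimitiveAt x → NondegenerateZeroSum c X
    nondegenerate-zero-sum x-primitive with search (ℕ.pred p) | nondegenerate-or-p²∣Σ (x∪B⊆X (ℕ.pred p)) Σx∪B≡0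
    ... | inj₁ found | _ = found
    ... | inj₂ _ | inj₁ found = found
    ... | inj₂ (tel-a , tel-b) | inj₂ (p²∣Ga , p²∣Gb) =
      ⊥-elim (x-primitive (p∣ a tel-a p²∣Ga , p∣ b tel-b p²∣Gb))
      where
      p∣ : ∀ f → Telescoped f (ℕ.pred p) → p² ∣ Σₛ f (⁅ x ⁆ ∪ B (ℕ.pred p)) → + p ∣ f x
      p∣ f tel p²∣G = p²∣X+[p-1]X⇒p∣X (subst (p² ∣_) (Σ-x∪B f (ℕ.pred p)) p²∣G) tel

  nondegenerate-zero-sum : ∀ (c : Fin m → ℤ) L → Units c L → (∀ {i} → i ∈ L → PrimitiveAt i) →
                           ℕ.pred p ℕ.+ ℕ.pred p < ∣ L ∣ → NondegenerateZeroSum c L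
  nondegenerate-zero-sum c L units L-primitive large = around (∣p∣>0⇒Nonempty L (ℕ.<-≤-trans z<s large))
    where
    around : Nonempty L → NondegenerateZeroSum c L
    around (x , x∈L)
      with disjoint-subsets-of-size (L ─ ⁅ x ⁆) (ℕ.≤-pred (subst (_ <_) (∣p∣≡1+∣p─⁅x⁆∣ x∈L) large))
    ... | T₁ , T₂ , T₁⊆L-x , T₂⊆L-x , T₁∩T₂≡∅ , size₁ , size₂ =
      NondegenerateZeroSum-⊆ (∪-least (x∈p⇒⁅x⁆⊆p x∈L) (∪-least (L-x⊆L ∘ T₁⊆L-x) (L-x⊆L ∘ T₂⊆L-x)))
        (Telescope.nondegenerate-zero-sum c x (units ∘ L-x⊆L ∘ T₁⊆L-x) (units ∘ L-x⊆L ∘ T₂⊆L-x) size₁ size₂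
          (Empty-∩-⊆ ⊆-refl T₁⊆L-x x∉L-x) (Empty-∩-⊆ ⊆-refl T₂⊆L-x x∉L-x) T₁∩T₂≡∅ (L-primitive x∈L))
      where
      L-x⊆L : L ─ ⁅ x ⁆ ⊆ L
      L-x⊆L = p─q⊆p L ⁅ x ⁆
      x∉L-x : Empty (⁅ x ⁆ ∩ (L ─ ⁅ x ⁆))
      x∉L-x = Empty-∩-sym (Empty-─∩ L ⁅ x ⁆)

  short-zero-sum : ∀ (c : Fin m → ℤ) S → Units c S → p ≤ ∣ S ∣ →
                   ∃ λ B → B ⊆ S × Nonempty B × ∣ B ∣ ≤ p × Σₛ c B ≡ 0ℤ mod + p
  short-zero-sum c S units p≤∣S∣ with ∣p∣>0⇒Nonempty S (ℕ.<-≤-trans (ℕ.>-nonZero⁻¹ p) p≤∣S∣)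
  ... | y , y∈S
    with subset-of-size (S ─ ⁅ y ⁆) (subst (ℕ.pred p ≤_) (cong ℕ.pred (∣p∣≡1+∣p─⁅x⁆∣ y∈S)) (ℕ.pred-mono-≤ p≤∣S∣))
  ... | T , T⊆S-y , ∣T∣≡p-1
    with subset-sums-cover c T (units ∘ p─q⊆p S ⁅ y ⁆ ∘ T⊆S-y) (ℕ.≤-reflexive (sym ∣T∣≡p-1)) (- c y)
  ... | A , A⊆T , ΣA≡-y =
    ⁅ y ⁆ ∪ A , ∪-least (x∈p⇒⁅x⁆⊆p y∈S) (p─q⊆p S ⁅ y ⁆ ∘ T⊆S-y ∘ A⊆T) , (y , x∈p∪q⁺ (inj₁ (x∈⁅x⁆ y))) ,
    ∣y∪A∣≤p , Σy∪A≡0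
    where
    y∉A : Empty (⁅ y ⁆ ∩ A)
    y∉A = Empty-∩-⊆ ⊆-refl (T⊆S-y ∘ A⊆T) (Empty-∩-sym (Empty-─∩ S ⁅ y ⁆))
    ∣y∪A∣≤p : ∣ ⁅ y ⁆ ∪ A ∣ ≤ p
    ∣y∪A∣≤p = begin
      ∣ ⁅ y ⁆ ∪ A ∣          ≡⟨ ∣p∪q∣≡∣p∣+∣q∣ ⁅ y ⁆ A y∉A ⟩
      ∣ ⁅ y ⁆ ∣ ℕ.+ ∣ A ∣    ≡⟨ cong (ℕ._+ ∣ A ∣) (∣⁅x⁆∣≡1 y) ⟩
      suc ∣ A ∣              ≤⟨ s≤s (p⊆q⇒∣p∣≤∣q∣ A⊆T) ⟩
      suc ∣ T ∣              ≡⟨ cong suc ∣T∣≡p-1 ⟩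
      suc (ℕ.pred p)         ≡⟨ ℕ.suc-pred p ⟩
      p                      ∎
      where open ℕ.≤-Reasoning
    Σy∪A≡0 : Σₛ c (⁅ y ⁆ ∪ A) ≡ 0ℤ mod + p
    Σy∪A≡0 = begin
      Σₛ c (⁅ y ⁆ ∪ A)        ≡⟨ Σₛ-∪ c ⁅ y ⁆ A y∉A ⟩
      Σₛ c ⁅ y ⁆ + Σₛ c A     ≡⟨ cong (_+ Σₛ c A) (Σₛ-⁅⁆ c y) ⟩
      c y + Σₛ c A            ≈⟨ +-congˡ-mod (c y) ΣA≡-y ⟩
      c y - c y               ≡⟨ ℤ.+-inverseʳ (c y) ⟩
      0ℤ                      ∎
      where open ≡mod-Reasoning (+ p)

  ShortNondegenerateZeroSum : (Fin m → ℤ) → Subset m → Set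
  ShortNondegenerateZeroSum c X = ∃ λ (z : NondegenerateZeroSum c X) → ∣ NondegenerateZeroSum.set z ∣ ≤ p

  private
    -- A zero-sum B ⊆ S with ∣ B ∣ ≤ p either is nondegenerate itself or leaves the nondegenerate S ─ B.
    shorten-within : ∀ (c : Fin m → ℤ) X n → Units c X → (z : NondegenerateZeroSum c X) →
                     ∣ NondegenerateZeroSum.set z ∣ ≤ n → ShortNondegenerateZeroSum c X
    shorten-within c X zero    units z ∣S∣≤0 = z , ℕ.≤-trans ∣S∣≤0 ℕ.z≤n
    shorten-within c X (suc n) units z@(nondegenerate S S⊆X ΣS≡0 p²∤ΣS) ∣S∣≤1+n with ∣ S ∣ ℕ.≤? p
    ... | yes ∣S∣≤p = z , ∣S∣≤p
    ... | no  ∣S∣≰p = split (short-zero-sum c S (units ∘ S⊆X) (ℕ.<⇒≤ (ℕ.≰⇒> ∣S∣≰p)))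
      where
      split : (∃ λ B → B ⊆ S × Nonempty B × ∣ B ∣ ≤ p × Σₛ c B ≡ 0ℤ mod + p) → ShortNondegenerateZeroSum c X
      split (B , B⊆S , (y , y∈B) , ∣B∣≤p , ΣB≡0) with p²∣Σ? B
      ... | no  p²∤ΣB = nondegenerate B (S⊆X ∘ B⊆S) ΣB≡0 p²∤ΣB , ∣B∣≤p
      ... | yes (p²∣ΣBa , p²∣ΣBb) = shorten-within c X n units
              (nondegenerate (S ─ B) (S⊆X ∘ p─q⊆p S B) ΣS─B≡0 p²∤ΣS─B)
              (ℕ.≤-pred (ℕ.<-≤-trans (p∩q≢∅⇒∣p─q∣<∣p∣ S B (y , x∈p∩q⁺ (B⊆S y∈B , y∈B))) ∣S∣≤1+n))
        where
        ΣS─B≡0 : Σₛ c (S ─ B) ≡ 0ℤ mod + p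
        ΣS─B≡0 = begin
          Σₛ c (S ─ B)               ≡⟨ ℤ.+-identityʳ (Σₛ c (S ─ B)) ⟨
          Σₛ c (S ─ B) + 0ℤ          ≈⟨ +-congˡ-mod (Σₛ c (S ─ B)) (≡mod-sym ΣB≡0) ⟩
          Σₛ c (S ─ B) + Σₛ c B      ≡⟨ Σₛ-─ c B⊆S ⟨
          Σₛ c S                     ≈⟨ ΣS≡0 ⟩
          0ℤ                         ∎
          where open ≡mod-Reasoning (+ p)
        p²∤ΣS─B : ¬ p²∣Σ (S ─ B)
        p²∤ΣS─B (p²∣Σa , p²∣Σb) = p²∤ΣS
          ( subst (p² ∣_) (sym (Σₛ-─ a B⊆S)) (∣m∣n⇒∣m+n p²∣Σa p²∣ΣBa)
          , subst (p² ∣_) (sym (Σₛ-─ b B⊆S)) (∣m∣n⇒∣m+n p²∣Σb p²∣ΣBb))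

  shorten : ∀ (c : Fin m → ℤ) X → Units c X → NondegenerateZeroSum c X → ShortNondegenerateZeroSum c X
  shorten c X units z = shorten-within c X _ units z ℕ.≤-refl

module Contractions {p : ℕ} (p-prime : Prime p) {m : ℕ} (a b : Fin m → ℤ) where
  private instance _ = prime⇒nonZero p-prime
  open import Data.Integer using (_+_; _-_; _*_; -_)
  open Residues p
  open SubsetSumsModPrime p-prime
  open NondegenerateZeroSums p-prime a b

  -- The line of slope zero is a ≡ 0; the line of slope suc t is b ≡ t · a.
  α β : Fin (suc p) → ℤ
  α zero    = 0ℤ
  α (suc _) = 1ℤ
  β zero    = 1ℤ
  β (suc t) = + toℕ t

  private
    line : ∀ i → Dec (+ p ∣ a i) → Fin (suc p) × ℤ
    line i (yes _)      = zero , b i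
    line i (no  a-unit) = suc (residue (b i * proj₁ (inverse-mod p-prime a-unit))) , a i

  slope : Fin m → Fin (suc p)
  slope i = proj₁ (line i (+ p ∣? a i))

  scale : Fin m → ℤ
  scale i = proj₂ (line i (+ p ∣? a i))

  OnLine : Fin (suc p) → Fin m → Set
  OnLine ℓ i = Unit p (scale i) × a i ≡ α ℓ * scale i mod + p × b i ≡ β ℓ * scale i mod + p

  on-slope : ∀ i → PrimitiveAt i → OnLine (slope i) i
  on-slope i i-primitive with + p ∣? a i
  ... | yes p∣a  = (λ p∣b → i-primitive (p∣a , p∣b))
                 , ≡mod-trans (∣⇒≡0-mod p∣a) (≡mod-reflexive (sym (ℤ.*-zeroˡ (b i))))
                 , ≡mod-reflexive (sym (ℤ.*-identityˡ (b i)))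
  ... | no a-unit = a-unit , ≡mod-reflexive (sym (ℤ.*-identityˡ (a i))) , (begin
    b i                            ≡⟨ ℤ.*-identityʳ (b i) ⟨
    b i * 1ℤ                       ≈⟨ *-congˡ-mod (b i) (≡mod-sym (proj₂ (inverse-mod p-prime a-unit))) ⟩
    b i * (a i * a⁻¹)              ≡⟨ eq (b i) (a i) a⁻¹ ⟩
    a i * (b i * a⁻¹)              ≈⟨ *-congˡ-mod (a i) (≡residue (b i * a⁻¹)) ⟩
    a i * + toℕ (residue (b i * a⁻¹)) ≡⟨ ℤ.*-comm (a i) _ ⟩
    + toℕ (residue (b i * a⁻¹)) * a i ∎)
    where
    open ≡mod-Reasoning (+ p)
    a⁻¹ : ℤ
    a⁻¹ = proj₁ (inverse-mod p-prime a-unit)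
    eq : ∀ b a a⁻¹ → b * (a * a⁻¹) ≡ a * (b * a⁻¹)
    eq = solve-∀

  record IsContraction (S : Subset m) : Set where
    field
      size≤p : ∣ S ∣ ≤ p
      p∣Σa   : + p ∣ Σₛ a S
      p∣Σb   : + p ∣ Σₛ b S
      p²∤Σ   : ¬ p²∣Σ S

  private
    p∣Σ-on-line : ∀ {f : Fin m → ℤ} k S → (∀ {i} → i ∈ S → f i ≡ k * scale i mod + p) →
                  Σₛ scale S ≡ 0ℤ mod + p → + p ∣ Σₛ f S
    p∣Σ-on-line {f} k S f≡k*scale Σscale≡0 = ≡0-mod⇒∣ (begin
      Σₛ f S                       ≈⟨ Σₛ-cong-mod S f≡k*scale ⟩
      Σₛ (λ i → k * scale i) S     ≡⟨ Σₛ-*ˡ k scale S ⟩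
      k * Σₛ scale S               ≈⟨ *-congˡ-mod k Σscale≡0 ⟩
      k * 0ℤ                       ≡⟨ ℤ.*-zeroʳ k ⟩
      0ℤ                           ∎)
      where open ≡mod-Reasoning (+ p)

    on-fiber : (∀ i → PrimitiveAt i) → ∀ {ℓ} R {i} → i ∈ R ∩ fiber slope ℓ → OnLine ℓ i
    on-fiber all-primitive R {i} i∈ =
      subst (λ ℓ → OnLine ℓ i) (∈-fiber⁻ (proj₂ (x∈p∩q⁻ R _ i∈))) (on-slope i (all-primitive i))

  contraction-exists : (∀ i → PrimitiveAt i) → ∀ R → suc p ℕ.* (ℕ.pred p ℕ.+ ℕ.pred p) < ∣ R ∣ →
                       ∃ λ S → S ⊆ R × IsContraction S
  contraction-exists all-primitive R large = in-fiber (pigeonhole (ℕ.pred p ℕ.+ ℕ.pred p) slope R large)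
    where
    in-fiber : ∃ (λ ℓ → ℕ.pred p ℕ.+ ℕ.pred p < ∣ R ∩ fiber slope ℓ ∣) → ∃ λ S → S ⊆ R × IsContraction S
    in-fiber (ℓ , large-fiber) = contraction (shorten scale L (proj₁ ∘ on-line)
      (nondegenerate-zero-sum scale L (proj₁ ∘ on-line) (λ {i} _ → all-primitive i) large-fiber))
      where
      L : Subset m
      L = R ∩ fiber slope ℓ
      on-line : ∀ {i} → i ∈ L → OnLine ℓ i
      on-line = on-fiber all-primitive R
      contraction : ShortNondegenerateZeroSum scale L → ∃ λ S → S ⊆ R × IsContraction S
      contraction (nondegenerate S S⊆L Σscale≡0 p²∤ΣS , ∣S∣≤p) = S , proj₁ ∘ x∈p∩q⁻ R _ ∘ S⊆L , record
        { size≤p = ∣S∣≤p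
        ; p∣Σa   = p∣Σ-on-line (α ℓ) S (proj₁ ∘ proj₂ ∘ on-line ∘ S⊆L) Σscale≡0
        ; p∣Σb   = p∣Σ-on-line (β ℓ) S (proj₂ ∘ proj₂ ∘ on-line ∘ S⊆L) Σscale≡0
        ; p²∤Σ   = p²∤ΣS
        }

  data DisjointContractions : List (Subset m) → Set where
    []   : DisjointContractions []
    cons : ∀ {S L} → IsContraction S → Empty (S ∩ ⋃ L) → DisjointContractions L → DisjointContractions (S ∷ L)

  record Packing (N : ℕ) (R : Subset m) : Set where
    field
      parts        : List (Subset m)
      disjoint     : DisjointContractions parts
      ⋃parts⊆R     : ⋃ parts ⊆ R
      leftover<N   : ∣ R ─ ⋃ parts ∣ < N
      N≤leftover+p : N ≤ ∣ R ─ ⋃ parts ∣ ℕ.+ p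

  private
    nothing-packed : ∀ {N R} → ∣ R ∣ < N → N ≤ ∣ R ∣ ℕ.+ p → Packing N R
    nothing-packed {N} {R} ∣R∣<N N≤∣R∣+p = record
      { parts        = []
      ; disjoint     = []
      ; ⋃parts⊆R     = ⊥⊆
      ; leftover<N   = subst (λ X → ∣ X ∣ < N) (sym (p─⊥≡p R)) ∣R∣<N
      ; N≤leftover+p = subst (λ X → N ≤ ∣ X ∣ ℕ.+ p) (sym (p─⊥≡p R)) N≤∣R∣+p
      }

    add-part : ∀ {N R S} → S ⊆ R → IsContraction S → Packing N (R ─ S) → Packing N R
    add-part {N} {R} {S} S⊆R S-contraction packing = record
      { parts        = S ∷ parts
      ; disjoint     = cons S-contraction (Empty-∩-⊆ ⊆-refl ⋃parts⊆R (Empty-∩-sym (Empty-─∩ R S))) disjoint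
      ; ⋃parts⊆R     = ∪-least S⊆R (p─q⊆p R S ∘ ⋃parts⊆R)
      ; leftover<N   = subst (λ X → ∣ X ∣ < N) (p─q─r≡p─q∪r R S (⋃ parts)) leftover<N
      ; N≤leftover+p = subst (λ X → N ≤ ∣ X ∣ ℕ.+ p) (p─q─r≡p─q∪r R S (⋃ parts)) N≤leftover+p
      }
      where open Packing packing

  greedy-packing : (∀ i → PrimitiveAt i) → ∀ {N} → suc p ℕ.* (ℕ.pred p ℕ.+ ℕ.pred p) < N →
                   ∀ R → N ≤ ∣ R ∣ ℕ.+ p → Packing N R
  greedy-packing all-primitive {N} N-large R = pack (∣ R ∣) R ℕ.≤-refl
    where
    pack : ∀ n R → ∣ R ∣ ≤ n → N ≤ ∣ R ∣ ℕ.+ p → Packing N R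
    pack zero    R ∣R∣≤0   N≤∣R∣+p = nothing-packed (ℕ.≤-<-trans ∣R∣≤0 (ℕ.<-≤-trans ℕ.z<s N-large)) N≤∣R∣+p
    pack (suc n) R ∣R∣≤1+n N≤∣R∣+p with ∣ R ∣ ℕ.<? N
    ... | yes ∣R∣<N = nothing-packed ∣R∣<N N≤∣R∣+p
    ... | no  ∣R∣≮N = add (contraction-exists all-primitive R (ℕ.<-≤-trans N-large (ℕ.≮⇒≥ ∣R∣≮N)))
      where
      add : ∃ (λ S → S ⊆ R × IsContraction S) → Packing N R
      add (S , S⊆R , S-contraction) = add-part S⊆R S-contraction (pack n (R ─ S) ∣R─S∣≤n N≤∣R─S∣+p)
        where
        open IsContraction S-contraction
        ∣R─S∣≤n : ∣ R ─ S ∣ ≤ n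
        ∣R─S∣≤n = ℕ.≤-pred (ℕ.<-≤-trans (p∩q≢∅⇒∣p─q∣<∣p∣ R S R∩S≢∅) ∣R∣≤1+n)
          where
          R∩S≢∅ : Nonempty (R ∩ S)
          R∩S≢∅ = let y , y∈S = p²∤Σ⇒Nonempty p²∤Σ in y , x∈p∩q⁺ (S⊆R y∈S , y∈S)
        N≤∣R─S∣+p : N ≤ ∣ R ─ S ∣ ℕ.+ p
        N≤∣R─S∣+p = begin
          N                     ≤⟨ ℕ.≮⇒≥ ∣R∣≮N ⟩
          ∣ R ∣                 ≡⟨ ∣p∣≡∣p─q∣+∣q∣ S⊆R ⟩
          ∣ R ─ S ∣ ℕ.+ ∣ S ∣   ≤⟨ ℕ.+-monoʳ-≤ ∣ R ─ S ∣ size≤p ⟩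
          ∣ R ─ S ∣ ℕ.+ p       ∎
          where open ℕ.≤-Reasoning

  lookup-contraction : ∀ {L} → DisjointContractions L → ∀ j → IsContraction (List.lookup L j)
  lookup-contraction (cons S-contraction _ _) zero    = S-contraction
  lookup-contraction (cons _ _ disjoint)      (suc j) = lookup-contraction disjoint j

  lookup-⊆-⋃ : ∀ (L : List (Subset m)) j → List.lookup L j ⊆ ⋃ L
  lookup-⊆-⋃ (S ∷ L) zero    = p⊆p∪q (⋃ L)
  lookup-⊆-⋃ (S ∷ L) (suc j) = q⊆p∪q S (⋃ L) ∘ lookup-⊆-⋃ L j

  lookup-disjoint : ∀ {L} → DisjointContractions L → ∀ j j′ → j ≢ j′ → Empty (List.lookup L j ∩ List.lookup L j′)
  lookup-disjoint (cons _ _ _)            zero    zero     j≢j′ = ⊥-elim (j≢j′ refl)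
  lookup-disjoint {S ∷ L} (cons _ S∩⋃L≡∅ _) zero    (suc j′) _    = Empty-∩-⊆ ⊆-refl (lookup-⊆-⋃ L j′) S∩⋃L≡∅
  lookup-disjoint {S ∷ L} (cons _ S∩⋃L≡∅ _) (suc j) zero     _    =
    Empty-∩-sym (Empty-∩-⊆ ⊆-refl (lookup-⊆-⋃ L j) S∩⋃L≡∅)
  lookup-disjoint (cons _ _ disjoint)     (suc j) (suc j′) j≢j′ = lookup-disjoint disjoint j j′ (j≢j′ ∘ cong suc)

  ∣⋃∣≤length*p : ∀ {L} → DisjointContractions L → ∣ ⋃ L ∣ ≤ List.length L ℕ.* p
  ∣⋃∣≤length*p {[]}    []                           = ℕ.≤-reflexive (∣⊥∣≡0 m)
  ∣⋃∣≤length*p {S ∷ L} (cons S-contraction S∩⋃L≡∅ disjoint) = begin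
    ∣ S ∪ ⋃ L ∣             ≡⟨ ∣p∪q∣≡∣p∣+∣q∣ S (⋃ L) S∩⋃L≡∅ ⟩
    ∣ S ∣ ℕ.+ ∣ ⋃ L ∣       ≤⟨ ℕ.+-mono-≤ (IsContraction.size≤p S-contraction) (∣⋃∣≤length*p disjoint) ⟩
    p ℕ.+ List.length L ℕ.* p    ∎
    where open ℕ.≤-Reasoning

open import Data.Nat using (_+_; _*_; _∸_; _^_)

⌈/⌉≤ : ∀ x q k → x ≤ k * q → ⌈ x / q ⌉ ≤ k
⌈/⌉≤ x zero    k _      = z≤n
⌈/⌉≤ x (suc q) k x≤k*q = ℕ.≤-pred (m<n*o⇒m/o<n (begin-strict
  x + q               ≤⟨ ℕ.+-monoˡ-≤ q x≤k*q ⟩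
  k * suc q + q       <⟨ ℕ.+-monoʳ-< (k * suc q) (ℕ.n<1+n q) ⟩
  k * suc q + suc q   ≡⟨ ℕ.+-comm (k * suc q) (suc q) ⟩
  suc k * suc q       ∎))
  where open ℕ.≤-Reasoning

pigeonhole-bound : ∀ p .{{_ : ℕ.NonZero p}} → suc p * (ℕ.pred p + ℕ.pred p) < 3 * p ^ 2 ∸ 2
pigeonhole-bound (suc q) = begin-strict
  X                        <⟨ s≤s (ℕ.m≤m+n X Y) ⟩
  suc (X + Y)              ≡⟨ ℕ.m+n∸m≡n 2 (suc (X + Y)) ⟨
  2 + suc (X + Y) ∸ 2      ≡⟨ cong (_∸ 2) (identity q) ⟨
  3 * suc q ^ 2 ∸ 2        ∎
  where
  open ℕ.≤-Reasoning
  X Y : ℕ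
  X = suc (suc q) * (q + q)
  Y = q * q + q + q
  identity : ∀ n → 3 * ((1 + n) * ((1 + n) * 1)) ≡ 2 + (1 + ((2 + n) * (n + n) + (n * n + n + n)))
  identity = ℕ-Solver.solve-∀

r<M∸2∧u≤K⇒r+u+3∸M≤K : ∀ M {r u K} → r < M ∸ 2 → u ≤ K → r + u + 3 ∸ M ≤ K
r<M∸2∧u≤K⇒r+u+3∸M≤K (suc (suc M)) {r} {u} {K} r<M u≤K = begin
  r + u + 3 ∸ suc (suc M)         ≤⟨ ℕ.∸-monoˡ-≤ (suc (suc M)) r+u+3≤M+2+K ⟩
  suc (suc M) + K ∸ suc (suc M)   ≡⟨ ℕ.m+n∸m≡n (suc (suc M)) K ⟩
  K                               ∎
  where
  open ℕ.≤-Reasoning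
  reorder : ∀ r u → suc (suc (suc r)) + u ≡ r + u + 3
  reorder = ℕ-Solver.solve-∀
  r+u+3≤M+2+K : r + u + 3 ≤ suc (suc M) + K
  r+u+3≤M+2+K = subst (_≤ suc (suc M) + K) (reorder r u) (ℕ.+-mono-≤ (s≤s (s≤s r<M)) u≤K)

M∸2≤r+p⇒M∸p∸2≤r : ∀ M {r p} → M ∸ 2 ≤ r + p → M ∸ p ∸ 2 ≤ r
M∸2≤r+p⇒M∸p∸2≤r M {r} {p} M∸2≤r+p = begin
  M ∸ p ∸ 2        ≡⟨ ℕ.∸-+-assoc M p 2 ⟩
  M ∸ (p + 2)      ≡⟨ cong (M ∸_) (ℕ.+-comm p 2) ⟩
  M ∸ (2 + p)      ≡⟨ ℕ.∸-+-assoc M 2 p ⟨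
  M ∸ 2 ∸ p        ≤⟨ ℕ.∸-monoˡ-≤ p M∸2≤r+p ⟩
  r + p ∸ p        ≡⟨ ℕ.m+n∸n≡m r p ⟩
  r                ∎
  where open ℕ.≤-Reasoning

module _ {p : ℕ} where

  seq-subsetSum : ∀ (π : ℤp² p → ℤ[ p ]) → (∀ x y → π (x +² y) ≡ π x +ₚ π y) → π 0² ≡ 0ₚ →
                  ∀ {m} (v : Fin m → ℤp² p) S k → seq (π (subsetSum v S)) k ≡ Σₛ (λ i → seq (π (v i)) k) S
  seq-subsetSum π π-+ π-0 v []            k = cong (λ x → seq x k) π-0
  seq-subsetSum π π-+ π-0 v (inside ∷ S)  k = trans (cong (λ x → seq x k) (π-+ _ _))
    (cong (ℤ._+_ (seq (π (v Fin.zero)) k)) (seq-subsetSum π π-+ π-0 (v ∘ Fin.suc) S k))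
  seq-subsetSum π π-+ π-0 v (outside ∷ S) k = trans (cong (λ x → seq x k) (π-+ _ _))
    (trans (cong₂ ℤ._+_ (cong (λ x → seq x k) π-0) (seq-subsetSum π π-+ π-0 (v ∘ Fin.suc) S k))
           (ℤ.+-identityˡ _))

  p∣seq₂⇒1∣ₚ : ∀ (x : ℤ[ p ]) → + p ∣ seq x 2 → 1 ∣ₚ x
  p∣seq₂⇒1∣ₚ x p∣x₂ = ≡0-mod⇒∣ (≡mod-trans (≡mod-sym (∣⇒≡mod (coh x 1)))
    (∣⇒≡0-mod (subst (_∣ seq x 2) (cong +_ (sym (ℕ.*-identityʳ p))) p∣x₂)))

-- Both levels of a sum are read off its integer representative modulo p², by coherence of ℤ_p elements.
module LevelTwoRepresentatives {p : ℕ} (p-prime : Prime p) {m : ℕ} (v : Fin m → ℤp² p) where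

  a b : Fin m → ℤ
  a i = seq (proj₁ (v i)) 2
  b i = seq (proj₂ (v i)) 2

  open NondegenerateZeroSums p-prime a b public using (PrimitiveAt; p²∤Σ⇒Nonempty)
  open Contractions p-prime a b public

  all-primitive : (∀ i → Primitive (v i)) → ∀ i → PrimitiveAt i
  all-primitive v-primitive i (p∣aᵢ , p∣bᵢ) =
    v-primitive i (p∣seq₂⇒1∣ₚ (proj₁ (v i)) p∣aᵢ , p∣seq₂⇒1∣ₚ (proj₂ (v i)) p∣bᵢ)

  contraction-levels : ∀ {S} → IsContraction S → (1 ∣² subsetSum v S) × ¬ (2 ∣² subsetSum v S)
  contraction-levels {S} S-contraction =
    ( p∣seq₂⇒1∣ₚ (proj₁ (subsetSum v S)) (subst (+ p ∣_) (sym Σa≡) p∣Σa)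
    , p∣seq₂⇒1∣ₚ (proj₂ (subsetSum v S)) (subst (+ p ∣_) (sym Σb≡) p∣Σb) )
    , λ (p²∣Σa , p²∣Σb) → p²∤Σ (subst (+ (p ^ 2) ∣_) Σa≡ p²∣Σa , subst (+ (p ^ 2) ∣_) Σb≡ p²∣Σb)
    where
    open IsContraction S-contraction
    Σa≡ : seq (proj₁ (subsetSum v S)) 2 ≡ Σₛ a S
    Σa≡ = seq-subsetSum proj₁ (λ _ _ → refl) refl v S 2
    Σb≡ : seq (proj₂ (subsetSum v S)) 2 ≡ Σₛ b S
    Σb≡ = seq-subsetSum proj₂ (λ _ _ → refl) refl v S 2

lemma11p1 : (p : ℕ) → Prime p → (m : ℕ) → 3 * p ^ 2 ∸ 2 ≤ m →
    (v : Fin m → ℤp² p) → (∀ i → Primitive (v i)) →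
    Σ ℕ (λ k → Σ (Fin k → Subset m) (λ S →
      (∀ j → Nonempty (S j)) ×
      (∀ j j′ → j ≢ j′ → Empty (S j ∩ S j′)) ×
      (∀ j → ∣ S j ∣ ≤ p) ×
      (∀ j → (1 ∣² subsetSum v (S j)) × ¬ (2 ∣² subsetSum v (S j))) ×
      (⌈ m + 3 ∸ 3 * p ^ 2 / p ⌉ ≤ k) ×
      (3 * p ^ 2 ∸ p ∸ 2 ≤ ∣ ∁ (⋃ (tabulate S)) ∣)))
lemma11p1 p p-prime m m-large v v-primitive =
  List.length parts , List.lookup parts ,
  p²∤Σ⇒Nonempty ∘ p²∤Σ ∘ part , lookup-disjoint disjoint , size≤p ∘ part , contraction-levels ∘ part ,
  ⌈/⌉≤ _ p _ (subst (λ n → n + 3 ∸ 3 * p ^ 2 ≤ List.length parts * p) (sym m≡leftover+used)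
    (r<M∸2∧u≤K⇒r+u+3∸M≤K (3 * p ^ 2) leftover<N (∣⋃∣≤length*p disjoint))) ,
  subst (λ L → 3 * p ^ 2 ∸ p ∸ 2 ≤ ∣ ∁ (⋃ L) ∣) (sym (tabulate-lookup parts))
    (subst (λ X → 3 * p ^ 2 ∸ p ∸ 2 ≤ ∣ X ∣) (⊤─p≡∁p (⋃ parts)) (M∸2≤r+p⇒M∸p∸2≤r (3 * p ^ 2) N≤leftover+p))
  where
  instance _ = prime⇒nonZero p-prime
  open LevelTwoRepresentatives p-prime v
  open IsContraction

  packing : Packing (3 * p ^ 2 ∸ 2) ⊤
  packing = greedy-packing (all-primitive v-primitive) (pigeonhole-bound p) ⊤
    (subst (λ n → 3 * p ^ 2 ∸ 2 ≤ n + p) (sym (∣⊤∣≡n m)) (ℕ.≤-trans m-large (ℕ.m≤m+n m p)))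
  open Packing packing

  part : ∀ j → IsContraction (List.lookup parts j)
  part = lookup-contraction disjoint

  m≡leftover+used : m ≡ ∣ ⊤ ─ ⋃ parts ∣ + ∣ ⋃ parts ∣
  m≡leftover+used = trans (sym (∣⊤∣≡n m)) (∣p∣≡∣p─q∣+∣q∣ {S = ⊤} {T = ⋃ parts} ⊆⊤)
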